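{- Let $n_1,n_2,n_3\ge 2$ and let $u=(x_1,x_2,x_3)$, $v=(y_1,y_2,y_3)$ be vertices of $P_{n_1}\Box P_{n_2}\Box P_{n_3}$ with $x_i\ne y_i$ for every $i\in\{1,2,3\}$. Then there are at least $n_1+n_2-2$ vertices $(z_1,z_2,z_3)$ resolving $u$ and $v$ with $z_3=n_3-1$ and either $z_1\in\{0,n_1-1\}$ or $z_2\in\{0,n_2-1\}$.
   Context: $P_{n_1}\Box P_{n_2}\Box P_{n_3}$ is the grid graph with vertex set $\{(x_1,x_2,x_3): 0\le x_i\le n_i-1\}$, two vertices adjacent iff they differ by exactly $1$ in exactly one coordinate; $d(x,y)=\sum_i|x_i-y_i|$. A vertex $w$ resolves $u,v$ if $d(w,u)\ne d(w,v)$. -}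

module Defs where

open import Data.Nat using (ℕ; _+_; ∣_-_∣; _≤_; _∸_; suc)
open import Data.Fin using (Fin; toℕ)
open import Data.Product using (_×_; _,_)
open import Data.Sum using (_⊎_)
open import Relation.Binary.PropositionalEquality using (_≡_; _≢_)

Vertex : ℕ → ℕ → ℕ → Set
Vertex n₁ n₂ n₃ = Fin n₁ × Fin n₂ × Fin n₃

dist : ∀ {n₁ n₂ n₃} → Vertex n₁ n₂ n₃ → Vertex n₁ n₂ n₃ → ℕ
dist (x₁ , x₂ , x₃) (y₁ , y₂ , y₃) =
  ∣ toℕ x₁ - toℕ y₁ ∣ + ∣ toℕ x₂ - toℕ y₂ ∣ + ∣ toℕ x₃ - toℕ y₃ ∣

Resolves : ∀ {n₁ n₂ n₃} → Vertex n₁ n₂ n₃ → Vertex n₁ n₂ n₃ → Vertex n₁ n₂ n₃ → Set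
Resolves w u v = dist w u ≢ dist w v

IsEnd : ∀ {n} → Fin n → Set
IsEnd {n} z = toℕ z ≡ 0 ⊎ toℕ z ≡ n ∸ 1

DiffAll : ∀ {n₁ n₂ n₃} → Vertex n₁ n₂ n₃ → Vertex n₁ n₂ n₃ → Set
DiffAll (x₁ , x₂ , x₃) (y₁ , y₂ , y₃) = x₁ ≢ y₁ × x₂ ≢ y₂ × x₃ ≢ y₃

TopBoundary : ∀ {n₁ n₂ n₃} → Vertex n₁ n₂ n₃ → Set
TopBoundary {n₃ = n₃} (z₁ , z₂ , z₃) = toℕ z₃ ≡ n₃ ∸ 1 × (IsEnd z₁ ⊎ IsEnd z₂)

module Submission where

-- Moving w along a line parallel to the first axis changes only the first term of d(w,u) and
-- d(w,v).  If w were equidistant from u and v at both ends of the line, then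
-- x₁ + R = y₁ + S and (n₁-1-x₁) + R = (n₁-1-y₁) + S, which forces x₁ = y₁.  So every line
-- {(·, t, n₃-1)} has a resolving end, and so has every line {(j, ·, n₃-1)} with 0 < j < n₁-1;
-- the interior first coordinate of the latter keeps these n₂ + (n₁-2) vertices distinct.

open import Defs
open import Data.Nat using (ℕ; _+_; _*_; _∸_; _≤_; s≤s; suc; ∣_-_∣; _≟_)
open import Data.Nat.Properties using (suc-injective; +-comm; +-assoc; +-cancelʳ-≡; *-cancelˡ-≡; m∸n+n≡m; m≤n⇒∣n-m∣≡n∸m; +-commutativeSemigroup; ≤-reflexive)
open import Data.Nat.Tactic.RingSolver using (solve-∀)
open import Algebra.Properties.CommutativeSemigroup +-commutativeSemigroup using (xy∙z≈y∙xz)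
open import Data.Fin using (Fin; toℕ; fromℕ; inject₁; splitAt) renaming (zero to fzero; suc to fsuc)
open import Data.Fin.Properties using (toℕ-injective; toℕ-fromℕ; toℕ≤pred[n]; toℕ-inject₁-≢; inject₁-injective; +↔⊎) renaming (suc-injective to fsuc-injective)
open import Data.Product using (Σ; _×_; _,_; proj₁; proj₂)
open import Data.Sum using (_⊎_; inj₁; inj₂)
open import Data.List using (List; length; tabulate)
open import Data.List.Properties using (length-tabulate)
open import Data.List.Relation.Unary.All using (All)
import Data.List.Relation.Unary.All.Properties as All
open import Data.List.Relation.Unary.Unique.Propositional using (Unique)
import Data.List.Relation.Unary.Unique.Propositional.Properties as Unique
open import Data.Empty using (⊥-elim)
open import Relation.Nullary using (¬_; yes; no)
open import Relation.Binary.PropositionalEquality using (_≡_; _≢_; refl; sym; trans; cong; cong₂; subst; subst₂; module ≡-Reasoning)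
open import Function using (_∘_)
open import Function.Bundles using (Injection)
open import Function.Properties.Inverse using (Inverse⇒Injection)

ends-separate : ∀ {a b L R S} → a ≤ L → b ≤ L →
  a + R ≡ b + S → (L ∸ a) + R ≡ (L ∸ b) + S → a ≡ b
ends-separate {a} {b} {L} {R} {S} a≤L b≤L eq₀ eqₗ =
  *-cancelˡ-≡ a b 2 (+-cancelʳ-≡ (L + (R + S)) (2 * a) (2 * b) doubled)
  where
  open ≡-Reasoning
  a′ b′ : ℕ
  a′ = L ∸ a
  b′ = L ∸ b
  regroup : ∀ p q x P Q → 2 * p + ((x + q) + (P + Q)) ≡ (p + P) + (x + Q) + (p + q)
  regroup = solve-∀
  doubled : 2 * a + (L + (R + S)) ≡ 2 * b + (L + (R + S))
  doubled = begin
    2 * a + (L + (R + S))           ≡⟨ cong (λ l → 2 * a + (l + (R + S))) (sym (m∸n+n≡m b≤L)) ⟩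
    2 * a + ((b′ + b) + (R + S))    ≡⟨ regroup a b b′ R S ⟩
    (a + R) + (b′ + S) + (a + b)    ≡⟨ cong₂ (λ p q → p + q + (a + b)) eq₀ (sym eqₗ) ⟩
    (b + S) + (a′ + R) + (a + b)    ≡⟨ cong ((b + S) + (a′ + R) +_) (+-comm a b) ⟩
    (b + S) + (a′ + R) + (b + a)    ≡⟨ sym (regroup b a a′ S R) ⟩
    2 * b + ((a′ + a) + (S + R))    ≡⟨ cong₂ (λ l r → 2 * b + (l + r)) (m∸n+n≡m a≤L) (+-comm S R) ⟩
    2 * b + (L + (R + S))           ∎

∣last-∣≡∸ : ∀ {m} (x : Fin (suc m)) → ∣ toℕ (fromℕ m) - toℕ x ∣ ≡ m ∸ toℕ x
∣last-∣≡∸ {m} x = trans (cong (∣_- toℕ x ∣) (toℕ-fromℕ m)) (m≤n⇒∣n-m∣≡n∸m (toℕ≤pred[n] x))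

fin-ends-separate : ∀ {m R S} (x y : Fin (suc m)) →
  ∣ toℕ (fzero {m}) - toℕ x ∣ + R ≡ ∣ toℕ (fzero {m}) - toℕ y ∣ + S →
  ∣ toℕ (fromℕ m) - toℕ x ∣ + R ≡ ∣ toℕ (fromℕ m) - toℕ y ∣ + S → x ≡ y
fin-ends-separate {R = R} {S} x y eq₀ eqₗ = toℕ-injective
  (ends-separate (toℕ≤pred[n] x) (toℕ≤pred[n] y) eq₀
    (subst₂ (λ p q → p + R ≡ q + S) (∣last-∣≡∸ x) (∣last-∣≡∸ y) eqₗ))

Equidistant : ∀ {n₁ n₂ n₃} → Vertex n₁ n₂ n₃ → Vertex n₁ n₂ n₃ → Vertex n₁ n₂ n₃ → Set
Equidistant w u v = dist w u ≡ dist w v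

resolving-end : ∀ {m n₁ n₂ n₃} {u v : Vertex n₁ n₂ n₃} (e : Fin (suc m) → Vertex n₁ n₂ n₃) →
  (Equidistant (e fzero) u v → Resolves (e (fromℕ m)) u v) →
  Σ (Fin (suc m)) λ c → IsEnd c × Resolves (e c) u v
resolving-end {m} {u = u} {v} e far-resolves with dist (e fzero) u ≟ dist (e fzero) v
... | yes eq = fromℕ m , inj₂ (toℕ-fromℕ m) , far-resolves eq
... | no neq = fzero , inj₁ refl , neq

dist₂₃ dist₁₃ : ∀ {n₁ n₂ n₃} → Vertex n₁ n₂ n₃ → Vertex n₁ n₂ n₃ → ℕ
dist₂₃ (_ , w₂ , w₃) (_ , x₂ , x₃) = ∣ toℕ w₂ - toℕ x₂ ∣ + ∣ toℕ w₃ - toℕ x₃ ∣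
dist₁₃ (w₁ , _ , w₃) (x₁ , _ , x₃) = ∣ toℕ w₁ - toℕ x₁ ∣ + ∣ toℕ w₃ - toℕ x₃ ∣

dist≡∣₁∣+dist₂₃ : ∀ {n₁ n₂ n₃} (w x : Vertex n₁ n₂ n₃) →
  dist w x ≡ ∣ toℕ (proj₁ w) - toℕ (proj₁ x) ∣ + dist₂₃ w x
dist≡∣₁∣+dist₂₃ (w₁ , _) (x₁ , _) = +-assoc ∣ toℕ w₁ - toℕ x₁ ∣ _ _

dist≡∣₂∣+dist₁₃ : ∀ {n₁ n₂ n₃} (w x : Vertex n₁ n₂ n₃) →
  dist w x ≡ ∣ toℕ (proj₁ (proj₂ w)) - toℕ (proj₁ (proj₂ x)) ∣ + dist₁₃ w x
dist≡∣₂∣+dist₁₃ (w₁ , w₂ , _) (x₁ , x₂ , _) = xy∙z≈y∙xz ∣ toℕ w₁ - toℕ x₁ ∣ ∣ toℕ w₂ - toℕ x₂ ∣ _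

first-ends-resolve : ∀ {m n₂ n₃} {u v : Vertex (suc m) n₂ n₃} → proj₁ u ≢ proj₁ v →
  (t : Fin n₂) (z : Fin n₃) →
  Equidistant (fzero , t , z) u v → Resolves (fromℕ m , t , z) u v
first-ends-resolve {m} {u = u} {v} x₁≢y₁ t z eq₀ eqₗ =
  x₁≢y₁ (fin-ends-separate (proj₁ u) (proj₁ v)
    (split (fzero , t , z) eq₀) (split (fromℕ m , t , z) eqₗ))
  where
  split : ∀ w → Equidistant w u v →
    ∣ toℕ (proj₁ w) - toℕ (proj₁ u) ∣ + dist₂₃ w u ≡ ∣ toℕ (proj₁ w) - toℕ (proj₁ v) ∣ + dist₂₃ w v
  split w eq = trans (sym (dist≡∣₁∣+dist₂₃ w u)) (trans eq (dist≡∣₁∣+dist₂₃ w v))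

second-ends-resolve : ∀ {n₁ m n₃} {u v : Vertex n₁ (suc m) n₃} → proj₁ (proj₂ u) ≢ proj₁ (proj₂ v) →
  (s : Fin n₁) (z : Fin n₃) →
  Equidistant (s , fzero , z) u v → Resolves (s , fromℕ m , z) u v
second-ends-resolve {m = m} {u = u} {v} x₂≢y₂ s z eq₀ eqₗ =
  x₂≢y₂ (fin-ends-separate (proj₁ (proj₂ u)) (proj₁ (proj₂ v))
    (split (s , fzero , z) eq₀) (split (s , fromℕ m , z) eqₗ))
  where
  split : ∀ w → Equidistant w u v →
    ∣ toℕ (proj₁ (proj₂ w)) - toℕ (proj₁ (proj₂ u)) ∣ + dist₁₃ w u ≡
    ∣ toℕ (proj₁ (proj₂ w)) - toℕ (proj₁ (proj₂ v)) ∣ + dist₁₃ w v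
  split w eq = trans (sym (dist≡∣₂∣+dist₁₃ w u)) (trans eq (dist≡∣₂∣+dist₁₃ w v))

injective⇒unique-list : ∀ {a p} {A : Set a} {P : A → Set p} {m} (f : Fin m → A) →
  (∀ {i j} → f i ≡ f j → i ≡ j) → (∀ i → P (f i)) →
  Σ (List A) λ zs → Unique zs × All P zs × m ≤ length zs
injective⇒unique-list f f-injective Pf =
  tabulate f , Unique.tabulate⁺ f-injective , All.tabulate⁺ Pf , ≤-reflexive (sym (length-tabulate f))

splitAt-injective : ∀ {m n} {i j : Fin (m + n)} → splitAt m i ≡ splitAt m j → i ≡ j
splitAt-injective = Injection.injective (Inverse⇒Injection +↔⊎)

interior : ∀ {k} → Fin k → Fin (suc (suc k))
interior = fsuc ∘ inject₁

interior-injective : ∀ {k} {i j : Fin k} → interior i ≡ interior j → i ≡ j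
interior-injective = inject₁-injective ∘ fsuc-injective

interior-not-end : ∀ {k} (j : Fin k) → ¬ IsEnd (interior j)
interior-not-end j (inj₁ ())
interior-not-end j (inj₂ eq) = toℕ-inject₁-≢ j (sym (suc-injective eq))

module TopResolvers {k₁ m₂ k₃} {u v : Vertex (suc (suc k₁)) (suc m₂) (suc k₃)}
  (x₁≢y₁ : proj₁ u ≢ proj₁ v) (x₂≢y₂ : proj₁ (proj₂ u) ≢ proj₁ (proj₂ v)) where

  top : Fin (suc k₃)
  top = fromℕ k₃

  column-end : (t : Fin (suc m₂)) → Σ (Fin (suc (suc k₁))) λ c → IsEnd c × Resolves (c , t , top) u v
  column-end t = resolving-end {u = u} {v} (λ c → c , t , top)
    (first-ends-resolve {u = u} {v} x₁≢y₁ t top)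

  row-end : (j : Fin k₁) → Σ (Fin (suc m₂)) λ c → IsEnd c × Resolves (interior j , c , top) u v
  row-end j = resolving-end {u = u} {v} (λ c → interior j , c , top)
    (second-ends-resolve {u = u} {v} x₂≢y₂ (interior j) top)

  resolver : Fin k₁ ⊎ Fin (suc m₂) → Vertex (suc (suc k₁)) (suc m₂) (suc k₃)
  resolver (inj₁ j) = interior j , proj₁ (row-end j) , top
  resolver (inj₂ t) = proj₁ (column-end t) , t , top

  resolver-resolves-on-top : ∀ s → Resolves (resolver s) u v × TopBoundary (resolver s)
  resolver-resolves-on-top (inj₁ j) =
    proj₂ (proj₂ (row-end j)) , toℕ-fromℕ k₃ , inj₂ (proj₁ (proj₂ (row-end j)))
  resolver-resolves-on-top (inj₂ t) =
    proj₂ (proj₂ (column-end t)) , toℕ-fromℕ k₃ , inj₁ (proj₁ (proj₂ (column-end t)))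

  resolver-injective : ∀ {s s′} → resolver s ≡ resolver s′ → s ≡ s′
  resolver-injective {inj₁ j} {inj₁ j′} eq = cong inj₁ (interior-injective (cong proj₁ eq))
  resolver-injective {inj₁ j} {inj₂ t′} eq =
    ⊥-elim (interior-not-end j (subst IsEnd (sym (cong proj₁ eq)) (proj₁ (proj₂ (column-end t′)))))
  resolver-injective {inj₂ t} {inj₁ j′} eq =
    ⊥-elim (interior-not-end j′ (subst IsEnd (cong proj₁ eq) (proj₁ (proj₂ (column-end t)))))
  resolver-injective {inj₂ t} {inj₂ t′} eq = cong inj₂ (cong (proj₁ ∘ proj₂) eq)

lemma11 : (n₁ n₂ n₃ : ℕ) → 2 ≤ n₁ → 2 ≤ n₂ → 2 ≤ n₃ →
    (u v : Vertex n₁ n₂ n₃) →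
    DiffAll u v →
    Σ (List (Vertex n₁ n₂ n₃)) λ zs →
    Unique zs ×
    All (λ z → Resolves z u v × TopBoundary z) zs ×
    n₁ + n₂ ∸ 2 ≤ length zs
-- The hypothesis on the third coordinates is not needed.
lemma11 _ _ _ (s≤s (s≤s _)) (s≤s _) (s≤s _) u v (x₁≢y₁ , x₂≢y₂ , _) =
  injective⇒unique-list (resolver ∘ splitAt _)
    (splitAt-injective ∘ resolver-injective) (resolver-resolves-on-top ∘ splitAt _)
  where open TopResolvers x₁≢y₁ x₂≢y₂
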